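{- Let $S$ be a numerical monoid. The element $\{1\}\in\mathcal P_{\mathrm{fin}}(\mathbb N_0)$ is absolutely irreducible. Apart from this element, there are no absolutely irreducible elements in $\mathcal P_{\mathrm{fin},0}(S)$ nor in $\mathcal P_{\mathrm{fin}}(S)$.
   Context: A numerical monoid is an additive submonoid $S\subset\mathbb N_0$ with $\gcd(S)=1$. $\mathcal P_{\mathrm{fin}}(S)$ is the monoid of finite nonempty subsets of $S$ under set addition (identity $\{0\}$, its only unit) and $\mathcal P_{\mathrm{fin},0}(S)$ its submonoid of sets containing $0$. In such a monoid $H$, an atom is an element $A\ne\{0\}$ such that $A=B+C$ with $B,C\in H$ forces $B=\{0\}$ or $C=\{0\}$. A factorization of $X\in H$ is a finite multiset of atoms of $H$ whose sum is $X$; $\mathsf Z(X)$ denotes the set of factorizations of $X$. An atom $A$ is absolutely irreducible if $|\mathsf Z(nA)|=1$ for all $n\in\mathbb N$, where $nA$ is the $n$-fold sum $A+\dots+A$. -}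

module Defs where

open import Level using (0ℓ)
open import Data.Nat using (ℕ; zero; suc; _+_; _≤_)
open import Data.Nat.Divisibility using (_∣_)
open import Data.List using (List; []; _∷_; [_]; cartesianProductWith; foldr)
open import Data.List.Membership.Propositional using (_∈_)
open import Data.List.Relation.Unary.All using (All)
open import Data.Product using (_×_; _,_; proj₁; proj₂; Σ; ∃)
open import Data.Sum using (_⊎_)
open import Data.Empty using (⊥)
open import Relation.Nullary using (¬_)
open import Relation.Binary.PropositionalEquality using (_≡_)
open import Relation.Binary.Bundles using (Setoid)
open import Relation.Binary.Structures using (IsEquivalence)
import Data.List.Relation.Binary.Permutation.Setoid as PermS

record NumericalMonoid : Set₁ where
  field
    mem     : ℕ → Set
    mem-0   : mem 0
    mem-+   : ∀ {a b} → mem a → mem b → mem (a + b)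
    gcd-one : ∀ d → (∀ s → mem s → d ∣ s) → d ≡ 1

ℕ₀ : NumericalMonoid
ℕ₀ = record
  { mem = λ _ → ⊤′
  ; mem-0 = tt′
  ; mem-+ = λ _ _ → tt′
  ; gcd-one = λ d h → Data.Nat.Divisibility.∣1⇒≡1 (h 1 tt′)
  }
  where
  open import Data.Unit using () renaming (⊤ to ⊤′; tt to tt′)
  import Data.Nat.Divisibility

-- Finite subsets of ℕ₀, represented by lists; equality of sets is
-- extensional (same elements).

FSet : Set
FSet = List ℕ

infix 4 _≐_
_≐_ : FSet → FSet → Set
A ≐ B = ∀ x → (x ∈ A → x ∈ B) × (x ∈ B → x ∈ A)

≐-isEquivalence : IsEquivalence _≐_
≐-isEquivalence = record
  { refl  = λ x → (λ p → p) , (λ p → p)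
  ; sym   = λ e x → proj₂ (e x) , proj₁ (e x)
  ; trans = λ e f x → (λ p → proj₁ (f x) (proj₁ (e x) p))
                    , (λ p → proj₂ (e x) (proj₂ (f x) p))
  }

FSetSetoid : Setoid 0ℓ 0ℓ
FSetSetoid = record { Carrier = FSet ; _≈_ = _≐_ ; isEquivalence = ≐-isEquivalence }

infixl 6 _⊕_
_⊕_ : FSet → FSet → FSet
A ⊕ B = cartesianProductWith _+_ A B

𝟎 : FSet
𝟎 = [ 0 ]

Σset : List FSet → FSet
Σset = foldr _⊕_ 𝟎

_·_ : ℕ → FSet → FSet
zero  · A = 𝟎
suc n · A = A ⊕ (n · A)

NonEmpty : FSet → Set
NonEmpty A = ∃ λ x → x ∈ A

Pfin : NumericalMonoid → FSet → Set
Pfin S A = NonEmpty A × All (NumericalMonoid.mem S) A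

Pfin0 : NumericalMonoid → FSet → Set
Pfin0 S A = Pfin S A × (0 ∈ A)

IsAtom : (FSet → Set) → FSet → Set
IsAtom H A =
  H A × ¬ (A ≐ 𝟎) ×
  (∀ B C → H B → H C → A ≐ B ⊕ C → (B ≐ 𝟎) ⊎ (C ≐ 𝟎))

record Factorization (H : FSet → Set) (X : FSet) : Set where
  field
    atoms    : List FSet
    all-atom : All (IsAtom H) atoms
    sums-to  : Σset atoms ≐ X

-- two factorizations are equal iff they are the same multiset of
-- elements of H (elements of H compared as sets)
_≈Z_ : ∀ {H X} → Factorization H X → Factorization H X → Set
z₁ ≈Z z₂ = PermS._↭_ FSetSetoid (Factorization.atoms z₁) (Factorization.atoms z₂)

UniqueFactorization : (FSet → Set) → FSet → Set
UniqueFactorization H X =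
  Factorization H X × (∀ (z₁ z₂ : Factorization H X) → z₁ ≈Z z₂)

AbsolutelyIrreducible : (FSet → Set) → FSet → Set
AbsolutelyIrreducible H A =
  IsAtom H A × (∀ n → 1 ≤ n → UniqueFactorization H (n · A))

{-# OPTIONS --safe #-}
-- If A is absolutely irreducible, the only factorization of nA is n copies of A; hence whenever
-- Y + Z = nA with Y and Z factorable, Y is itself a multiple kA.  (Factorizations exist up to
-- double negation, by induction on the maximum.)  If A has least element a < greatest element m,
-- pigeonhole gives {a, m} + jA = (1 + j)A for large j, forcing A = {a, m}; but then
-- {2a, 2m} + A = 3A while {2a, 2m} is no multiple of A.  For A = {a} ∈ P_fin(S) and s ∈ S,
-- {s} + {(a - 1)s} = s{a} makes {s} a multiple of {a}, so a divides all of S and gcd(S) = 1 gives a = 1.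
-- Finally every factorization of {n} ∈ P_fin(ℕ₀) consists of singletons, which must all be {1}.
module Submission where

open import Defs
open import Data.Nat
open import Data.Nat.Properties
open import Data.Nat.Induction using (<-wellFounded)
open import Data.Nat.Divisibility using (_∣_; divides; _∣?_; _∣0)
open import Data.Nat.Tactic.RingSolver using (solve-∀)
open import Data.List using (List; []; _∷_; [_]; _++_; replicate; length)
open import Data.List.Extrema.Nat using (min; max; argmin-sel; argmax-sel; min≤⊤; min≤xs; ⊥≤max; xs≤max; max<v⁺)
open import Data.List.Membership.Propositional using (_∈_; _∉_; find)
open import Data.List.Membership.Propositional.Properties using (∈-cartesianProductWith⁺; ∈-cartesianProductWith⁻)
open import Data.List.Relation.Binary.Subset.Propositional using (_⊆_)
open import Data.List.Relation.Binary.Subset.Propositional.Properties using (⊆-refl)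
open import Data.List.Relation.Unary.Any using (here; there)
open import Data.List.Relation.Unary.Any.Properties using (singleton⁻)
open import Data.List.Relation.Unary.All as All using (All; []; _∷_; all?; lookup)
open import Data.List.Relation.Unary.All.Properties using (++⁺; ++⁻ˡ; replicate⁺; ¬All⇒Any¬)
import Data.List.Relation.Binary.Permutation.Setoid as Permutation
import Data.List.Relation.Binary.Permutation.Setoid.Properties as PermutationProperties
open import Data.Product using (_×_; _,_; proj₁; proj₂; ∃; ∃₂)
open import Data.Sum using (_⊎_; inj₁; inj₂; [_,_]′)
open import Data.Empty using (⊥; ⊥-elim)
open import Data.Unit using (tt)
open import Function using (_∘_)
open import Induction.WellFounded using (WellFounded; WfRec)
import Induction.WellFounded as WF
open import Level using (0ℓ)
open import Relation.Nullary using (¬_; yes; no)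
open import Relation.Binary using (Setoid)
import Relation.Binary.Construct.On as On
import Relation.Binary.Reasoning.Setoid as SetoidReasoning
open import Relation.Binary.PropositionalEquality using (_≡_; refl; sym; trans; cong; subst; subst₂; module ≡-Reasoning)

open Setoid FSetSetoid using () renaming (refl to ≐-refl; reflexive to ≐-reflexive; sym to ≐-sym; trans to ≐-trans)
open Permutation FSetSetoid using (_↭_; prep; ↭-refl)

⊆-antisym : ∀ {A B} → A ⊆ B → B ⊆ A → A ≐ B
⊆-antisym A⊆B B⊆A x = A⊆B , B⊆A

≐⇒⊆ : ∀ {A B} → A ≐ B → A ⊆ B
≐⇒⊆ A≐B {x} = proj₁ (A≐B x)

≐⇒⊇ : ∀ {A B} → A ≐ B → B ⊆ A
≐⇒⊇ A≐B {x} = proj₂ (A≐B x)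

≐-[]⇒≡ : ∀ {x y} → [ x ] ≐ [ y ] → x ≡ y
≐-[]⇒≡ {x} e = singleton⁻ (proj₁ (e x) (here refl))

∈-⊕⁺ : ∀ {A B a b} → a ∈ A → b ∈ B → a + b ∈ A ⊕ B
∈-⊕⁺ = ∈-cartesianProductWith⁺ _+_

∈-⊕⁻ : ∀ A B {x} → x ∈ A ⊕ B → ∃₂ λ a b → a ∈ A × b ∈ B × x ≡ a + b
∈-⊕⁻ = ∈-cartesianProductWith⁻ _+_

∈-⊕⁺′ : ∀ {A B a b x} → a ∈ A → b ∈ B → x ≡ a + b → x ∈ A ⊕ B
∈-⊕⁺′ a∈A b∈B refl = ∈-⊕⁺ a∈A b∈B

⊕-mono-⊆ : ∀ {A A′ B B′} → A ⊆ A′ → B ⊆ B′ → A ⊕ B ⊆ A′ ⊕ B′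
⊕-mono-⊆ {A} {B = B} A⊆A′ B⊆B′ x∈ with ∈-⊕⁻ A B x∈
... | _ , _ , a∈A , b∈B , refl = ∈-⊕⁺ (A⊆A′ a∈A) (B⊆B′ b∈B)

⊕-cong : ∀ {A A′ B B′} → A ≐ A′ → B ≐ B′ → A ⊕ B ≐ A′ ⊕ B′
⊕-cong A≐A′ B≐B′ = ⊆-antisym (⊕-mono-⊆ (≐⇒⊆ A≐A′) (≐⇒⊆ B≐B′)) (⊕-mono-⊆ (≐⇒⊇ A≐A′) (≐⇒⊇ B≐B′))

⊕-comm : ∀ A B → A ⊕ B ≐ B ⊕ A
⊕-comm A B = ⊆-antisym (swap A B) (swap B A)
  where
  swap : ∀ A B → A ⊕ B ⊆ B ⊕ A
  swap A B x∈ with ∈-⊕⁻ A B x∈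
  ... | a , b , a∈A , b∈B , refl = ∈-⊕⁺′ b∈B a∈A (+-comm a b)

⊕-assoc : ∀ A B C → A ⊕ B ⊕ C ≐ A ⊕ (B ⊕ C)
⊕-assoc A B C = ⊆-antisym to from
  where
  to : A ⊕ B ⊕ C ⊆ A ⊕ (B ⊕ C)
  to x∈ with ∈-⊕⁻ (A ⊕ B) C x∈
  ... | _ , c , ab∈ , c∈C , refl with ∈-⊕⁻ A B ab∈
  ... | a , b , a∈A , b∈B , refl = ∈-⊕⁺′ a∈A (∈-⊕⁺ b∈B c∈C) (+-assoc a b c)
  from : A ⊕ (B ⊕ C) ⊆ A ⊕ B ⊕ C
  from x∈ with ∈-⊕⁻ A (B ⊕ C) x∈
  ... | a , _ , a∈A , bc∈ , refl with ∈-⊕⁻ B C bc∈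
  ... | b , c , b∈B , c∈C , refl = ∈-⊕⁺′ (∈-⊕⁺ a∈A b∈B) c∈C (sym (+-assoc a b c))

⊕-identityʳ : ∀ A → A ⊕ 𝟎 ≐ A
⊕-identityʳ A = ⊆-antisym to (λ {x} x∈A → ∈-⊕⁺′ x∈A (here refl) (sym (+-identityʳ x)))
  where
  to : A ⊕ 𝟎 ⊆ A
  to x∈ with ∈-⊕⁻ A 𝟎 x∈
  ... | a , _ , a∈A , here refl , refl = subst (_∈ A) (sym (+-identityʳ a)) a∈A

⊕-identityˡ : ∀ A → 𝟎 ⊕ A ≐ A
⊕-identityˡ A = ≐-trans (⊕-comm 𝟎 A) (⊕-identityʳ A)

positive⇒≉𝟎 : ∀ {A x} → x ∈ A → 0 < x → ¬ A ≐ 𝟎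
positive⇒≉𝟎 {x = x} x∈A 0<x A≐𝟎 = >⇒≢ 0<x (singleton⁻ (proj₁ (A≐𝟎 x) x∈A))

zero-or-positive : ∀ {A} → NonEmpty A → A ≐ 𝟎 ⊎ ∃ λ x → x ∈ A × 0 < x
zero-or-positive {A} (y , y∈A) with all? (_≟ 0) A
... | yes allZero = inj₁ (⊆-antisym (λ x∈A → here (lookup allZero x∈A))
                                    λ { (here refl) → subst (_∈ A) (lookup allZero y∈A) y∈A ; (there ()) })
... | no ¬allZero with find (¬All⇒Any¬ (_≟ 0) A ¬allZero)
...   | x , x∈A , x≢0 = inj₂ (x , x∈A , n≢0⇒n>0 x≢0)

∈-·⁺ : ∀ {A x} k → x ∈ A → k * x ∈ k · A
∈-·⁺ zero    x∈A = here refl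
∈-·⁺ (suc k) x∈A = ∈-⊕⁺ x∈A (∈-·⁺ k x∈A)

∈-·⇒≤ : ∀ {A m x} k → All (_≤ m) A → x ∈ k · A → x ≤ k * m
∈-·⇒≤ zero    A≤m (here refl) = z≤n
∈-·⇒≤ {A} (suc k) A≤m x∈ with ∈-⊕⁻ A (k · A) x∈
... | a , y , a∈A , y∈ , refl = +-mono-≤ (lookup A≤m a∈A) (∈-·⇒≤ k A≤m y∈)

·-cong : ∀ {A B} k → A ≐ B → k · A ≐ k · B
·-cong zero    A≐B = ≐-refl
·-cong (suc k) A≐B = ⊕-cong A≐B (·-cong k A≐B)

·-identityˡ : ∀ A → 1 · A ≐ A
·-identityˡ = ⊕-identityʳ

·-distribʳ-+ : ∀ A k l → (k + l) · A ≐ k · A ⊕ l · A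
·-distribʳ-+ A zero    l = ≐-sym (⊕-identityˡ (l · A))
·-distribʳ-+ A (suc k) l =
  ≐-trans (⊕-cong (≐-refl {A}) (·-distribʳ-+ A k l)) (≐-sym (⊕-assoc A (k · A) (l · A)))

·-[] : ∀ k a → k · [ a ] ≡ [ k * a ]
·-[] zero    a = refl
·-[] (suc k) a = cong (λ X → [ a ] ⊕ X) (·-[] k a)

Σset-replicate : ∀ n A → Σset (replicate n A) ≡ n · A
Σset-replicate zero    A = refl
Σset-replicate (suc n) A = cong (A ⊕_) (Σset-replicate n A)

Σset-++ : ∀ xs ys → Σset (xs ++ ys) ≐ Σset xs ⊕ Σset ys
Σset-++ []       ys = ≐-sym (⊕-identityˡ (Σset ys))
Σset-++ (X ∷ xs) ys = ≐-trans (⊕-cong (≐-refl {X}) (Σset-++ xs ys)) (≐-sym (⊕-assoc X (Σset xs) (Σset ys)))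

Σset-all≐ : ∀ {A} xs → All (_≐ A) xs → Σset xs ≐ length xs · A
Σset-all≐ []       []              = ≐-refl
Σset-all≐ (X ∷ xs) (X≐A ∷ xs≐A) = ⊕-cong X≐A (Σset-all≐ xs xs≐A)

Σset-nonEmpty : ∀ xs → All NonEmpty xs → NonEmpty (Σset xs)
Σset-nonEmpty []       []              = 0 , here refl
Σset-nonEmpty (X ∷ xs) ((x , x∈X) ∷ ne) with Σset-nonEmpty xs ne
... | y , y∈ = x + y , ∈-⊕⁺ x∈X y∈

⊕≐[]⁻ : ∀ {B C t} → NonEmpty B → NonEmpty C → B ⊕ C ≐ [ t ] →
        ∃₂ λ b c → B ≐ [ b ] × C ≐ [ c ] × b + c ≡ t
⊕≐[]⁻ {B} {C} {t} (b , b∈B) (c , c∈C) B⊕C≐[t] = b , c , B≐[b] , C≐[c] , sum b∈B c∈C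
  where
  sum : ∀ {x y} → x ∈ B → y ∈ C → x + y ≡ t
  sum x∈B y∈C = singleton⁻ (proj₁ (B⊕C≐[t] _) (∈-⊕⁺ x∈B y∈C))
  B≐[b] : B ≐ [ b ]
  B≐[b] = ⊆-antisym (λ x∈B → here (+-cancelʳ-≡ c _ b (trans (sum x∈B c∈C) (sym (sum b∈B c∈C)))))
                    λ { (here refl) → b∈B ; (there ()) }
  C≐[c] : C ≐ [ c ]
  C≐[c] = ⊆-antisym (λ y∈C → here (+-cancelˡ-≡ b _ c (trans (sum b∈B y∈C) (sym (sum b∈B c∈C)))))
                    λ { (here refl) → c∈C ; (there ()) }

all≐-↭ : ∀ {A xs ys} → All (_≐ A) xs → All (_≐ A) ys → length xs ≡ length ys → xs ↭ ys
all≐-↭ []               []               refl = ↭-refl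
all≐-↭ (X≐A ∷ xs≐A) (Y≐A ∷ ys≐A) eq   = prep (≐-trans X≐A (≐-sym Y≐A)) (all≐-↭ xs≐A ys≐A (suc-injective eq))

-- Factorizations

module _ {H : FSet → Set} where
  open Factorization

  factorization-≐ : ∀ {X Y} → X ≐ Y → Factorization H X → Factorization H Y
  factorization-≐ X≐Y z = record { atoms = atoms z ; all-atom = all-atom z ; sums-to = ≐-trans (sums-to z) X≐Y }

  _⊕ᶠ_ : ∀ {X Y} → Factorization H X → Factorization H Y → Factorization H (X ⊕ Y)
  zX ⊕ᶠ zY = record
    { atoms    = atoms zX ++ atoms zY
    ; all-atom = ++⁺ (all-atom zX) (all-atom zY)
    ; sums-to  = ≐-trans (Σset-++ (atoms zX) (atoms zY)) (⊕-cong (sums-to zX) (sums-to zY))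
    }

  replicateᶠ : ∀ {A} n → IsAtom H A → Factorization H (n · A)
  replicateᶠ {A} n A-atom = record
    { atoms = replicate n A ; all-atom = replicate⁺ n A-atom ; sums-to = ≐-reflexive (Σset-replicate n A) }

_≺_ : FSet → FSet → Set
X ≺ Y = max 0 X < max 0 Y

≺-wellFounded : WellFounded _≺_
≺-wellFounded = On.wellFounded (max 0) <-wellFounded

summand-≺ : ∀ {B C X c} → NonEmpty B → c ∈ C → 0 < c → B ⊕ C ⊆ X → B ≺ X
summand-≺ {B} {C} {X} {c} (b , b∈B) c∈C 0<c B⊕C⊆X = max<v⁺ (≤-<-trans z≤n (below b∈B)) (All.tabulate below)
  where
  below : ∀ {x} → x ∈ B → x < max 0 X
  below {x} x∈B = <-≤-trans (m<m+n x 0<c) (lookup (xs≤max 0 X) (B⊕C⊆X (∈-⊕⁺ x∈B c∈C)))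

module _ {H : FSet → Set} (H⇒nonEmpty : ∀ {X} → H X → NonEmpty X) where

  factorization : ∀ {X} → H X → ¬ ¬ Factorization H X
  factorization {X} = WF.All.wfRec ≺-wellFounded 0ℓ Factorable step X
    where
    Factorable : FSet → Set
    Factorable X = H X → ¬ ¬ Factorization H X

    step : ∀ X → WfRec _≺_ Factorable X → Factorable X
    step X rec hX ¬zX with zero-or-positive (H⇒nonEmpty hX)
    ... | inj₁ X≐𝟎              = ¬zX (record { atoms = [] ; all-atom = [] ; sums-to = ≐-sym X≐𝟎 })
    ... | inj₂ (x , x∈X , 0<x) = ¬zX (record { atoms = [ X ] ; all-atom = X-atom ∷ [] ; sums-to = ⊕-identityʳ X })
      where
      -- both summands of a nontrivial split are ≺ X, so their factorizations would factor X
      splits-trivially : ∀ B C → H B → H C → X ≐ B ⊕ C → B ≐ 𝟎 ⊎ C ≐ 𝟎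
      splits-trivially B C hB hC X≐B⊕C with zero-or-positive (H⇒nonEmpty hB) | zero-or-positive (H⇒nonEmpty hC)
      ... | inj₁ B≐𝟎 | _        = inj₁ B≐𝟎
      ... | inj₂ _   | inj₁ C≐𝟎 = inj₂ C≐𝟎
      ... | inj₂ (b , b∈B , 0<b) | inj₂ (c , c∈C , 0<c) = ⊥-elim (
        rec (summand-≺ (H⇒nonEmpty hB) c∈C 0<c (≐⇒⊇ X≐B⊕C)) hB λ zB →
        rec (summand-≺ (H⇒nonEmpty hC) b∈B 0<b (≐⇒⊇ (≐-trans X≐B⊕C (⊕-comm B C)))) hC λ zC →
        ¬zX (factorization-≐ (≐-sym X≐B⊕C) (zB ⊕ᶠ zC)))

      X-atom : IsAtom H X
      X-atom = hX , positive⇒≉𝟎 x∈X 0<x , splits-trivially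

module _ {H : FSet → Set} {A : FSet} (irr : AbsolutelyIrreducible H A) where
  open Factorization

  atoms-of-multiple : ∀ {n} → 1 ≤ n → (z : Factorization H (n · A)) → All (_≐ A) (atoms z)
  atoms-of-multiple {n} 1≤n z =
    PermutationProperties.All-resp-↭ FSetSetoid (λ X≐Y X≐A → ≐-trans (≐-sym X≐Y) X≐A)
      (proj₂ (proj₂ irr n 1≤n) (replicateᶠ n (proj₁ irr)) z) (replicate⁺ n ≐-refl)

  summand-of-multiple : ∀ {n Y Z} → 1 ≤ n → Factorization H Y → Factorization H Z →
                        Y ⊕ Z ≐ n · A → ∃ λ k → Y ≐ k · A
  summand-of-multiple 1≤n zY zZ Y⊕Z≐nA =
    length (atoms zY) ,
    ≐-trans (≐-sym (sums-to zY))
      (Σset-all≐ (atoms zY) (++⁻ˡ (atoms zY) (atoms-of-multiple 1≤n (factorization-≐ Y⊕Z≐nA (zY ⊕ᶠ zZ)))))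

-- Sums of k elements and the pigeonhole principle

-- Multisum B k s: s = Σ cᵢ bᵢ with Σ cᵢ = k, the bᵢ being the entries of B; a witness of s ∈ k · B.
data Multisum : List ℕ → ℕ → ℕ → Set where
  []  : Multisum [] 0 0
  _∷_ : ∀ {b B k s} c → Multisum B k s → Multisum (b ∷ B) (c + k) (c * b + s)

multisum-zero : ∀ B → Multisum B 0 0
multisum-zero []      = []
multisum-zero (b ∷ B) = 0 ∷ multisum-zero B

multisum-insert : ∀ {a B k s} → a ∈ B → Multisum B k s → Multisum B (suc k) (a + s)
multisum-insert {a} (here refl) (_∷_ {s = s} c M) = subst (Multisum _ _) (+-assoc a (c * a) s) (suc c ∷ M)
multisum-insert {a} (there a∈B) (_∷_ {b} {k = k} {s} c M) =
  subst₂ (Multisum _) (+-suc c k) (x+[y+z]≡y+[x+z] (c * b) a s) (c ∷ multisum-insert a∈B M)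
  where
  x+[y+z]≡y+[x+z] : ∀ x y z → x + (y + z) ≡ y + (x + z)
  x+[y+z]≡y+[x+z] = solve-∀

∈-·⇒multisum : ∀ {A x} k → x ∈ k · A → Multisum A k x
∈-·⇒multisum {A} zero    (here refl) = multisum-zero A
∈-·⇒multisum {A} (suc k) x∈ with ∈-⊕⁻ A (k · A) x∈
... | a , y , a∈A , y∈ , refl = multisum-insert a∈A (∈-·⇒multisum k y∈)

multisum⇒∈-· : ∀ {A B k s} → B ⊆ A → Multisum B k s → s ∈ k · A
multisum⇒∈-·         B⊆A []                      = here refl
multisum⇒∈-· {A} B⊆A (_∷_ {k = k} c M) =
  ≐⇒⊇ (·-distribʳ-+ A c k) (∈-⊕⁺ (∈-·⁺ c (B⊆A (here refl))) (multisum⇒∈-· (B⊆A ∘ there) M))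

pigeonhole : ∀ {B k s} d → Multisum B k s → d * length B < k →
             ∃ λ b → ∃₂ λ k′ s′ → b ∈ B × k ≡ suc d + k′ × s ≡ suc d * b + s′ × Multisum B k′ s′
pigeonhole d []                              d*0<0 = ⊥-elim (n≮0 d*0<0)
pigeonhole d (_∷_ {b} {B} {k} {s} c M) lt with suc d ≤? c
... | yes 1+d≤c with m≤n⇒∃[o]m+o≡n 1+d≤c
...   | c′ , refl = b , c′ + k , c′ * b + s , here refl , +-assoc (suc d) c′ k , distrib (suc d) c′ b s , c′ ∷ M
  where
  distrib : ∀ x y b s → (x + y) * b + s ≡ x * b + (y * b + s)
  distrib = solve-∀
pigeonhole d (_∷_ {b} {B} {k} {s} c M) lt | no 1+d≰c with pigeonhole d M k-large
  where
  k-large : d * length B < k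
  k-large = +-cancelˡ-< d _ _ (begin-strict
    d + d * length B   ≡⟨ *-suc d (length B) ⟨
    d * suc (length B) <⟨ lt ⟩
    c + k              ≤⟨ +-monoˡ-≤ k (m<1+n⇒m≤n (≰⇒> 1+d≰c)) ⟩
    d + k              ∎)
    where open ≤-Reasoning
... | b′ , k′ , s′ , b′∈B , refl , refl , M′ =
  b′ , c + k′ , c * b + s′ , there b′∈B , x+[y+z]≡y+[x+z] c (suc d) k′ , x+[y+z]≡y+[x+z] (c * b) (suc d * b′) s′ , c ∷ M′
  where
  x+[y+z]≡y+[x+z] : ∀ x y z → x + (y + z) ≡ y + (x + z)
  x+[y+z]≡y+[x+z] = solve-∀

-- Elements with least element a < greatest element m

pair : ℕ → ℕ → FSet
pair a m = a ∷ m ∷ []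

peel : ∀ {A a m j} → a ∈ A → m ∈ A → ∀ e r → e + r ≡ suc j → e * m + r * a ∈ pair a m ⊕ j · A
peel {A} {a} {m} {j} a∈A m∈A zero .(suc j) refl = ∈-⊕⁺ {pair a m} (here refl) (∈-·⁺ j a∈A)
peel {A} {a} {m} {j} a∈A m∈A (suc e) r 1+e+r≡1+j =
  ∈-⊕⁺′ {pair a m} {j · A} (there (here refl))
        (subst (λ n → _ ∈ n · A) (suc-injective 1+e+r≡1+j)
               (≐⇒⊇ (·-distribʳ-+ A e r) (∈-⊕⁺ (∈-·⁺ e m∈A) (∈-·⁺ r a∈A))))
        (+-assoc m (e * m) (r * a))

·-index : ∀ {A X m c k} → m ∈ A → All (_≤ m) A → 0 < m →
          c * m ∈ X → All (_≤ c * m) X → X ≐ k · A → k ≡ c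
·-index {m = m} {c} {k} m∈A A≤m 0<m cm∈X X≤cm X≐kA =
  *-cancelʳ-≡ k c m {{>-nonZero 0<m}} (≤-antisym km≤cm cm≤km)
  where
  km≤cm : k * m ≤ c * m
  km≤cm = lookup X≤cm (≐⇒⊇ X≐kA (∈-·⁺ k m∈A))
  cm≤km : c * m ≤ k * m
  cm≤km = ∈-·⇒≤ k A≤m (≐⇒⊆ X≐kA cm∈X)

-- among three elements of a two-element set, two coincide
doubled-⊕-pair : ∀ a m → pair (2 * a) (2 * m) ⊕ pair a m ≐ 3 · pair a m
doubled-⊕-pair a m = ⊆-antisym to from
  where
  P D : FSet
  P = pair a m
  D = pair (2 * a) (2 * m)

  twice : ∀ {p} → p ∈ P → 2 * p ∈ D
  twice (here refl)         = here refl
  twice (there (here refl)) = there (here refl)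

  split-first : ∀ p y → 2 * p + y ≡ p + (p + (y + 0))
  split-first = solve-∀
  split-outer : ∀ p q → p + (q + (p + 0)) ≡ 2 * p + q
  split-outer = solve-∀
  split-inner : ∀ p q → q + (p + (p + 0)) ≡ 2 * p + q
  split-inner = solve-∀

  to : D ⊕ P ⊆ 3 · P
  to x∈ with ∈-⊕⁻ D P x∈
  ... | _ , y , here refl , y∈P , refl =
    ∈-⊕⁺′ {P} (here refl) (∈-⊕⁺ {P} (here refl) (∈-⊕⁺ {P} {𝟎} y∈P (here refl))) (split-first a y)
  ... | _ , y , there (here refl) , y∈P , refl =
    ∈-⊕⁺′ {P} (there (here refl)) (∈-⊕⁺ {P} (there (here refl)) (∈-⊕⁺ {P} {𝟎} y∈P (here refl))) (split-first m y)

  triple : ∀ {x y z} → x ∈ P → y ∈ P → z ∈ P → x + (y + (z + 0)) ∈ D ⊕ P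
  triple x∈@(here refl)         (here refl)         z∈ = ∈-⊕⁺′ (twice x∈) z∈ (sym (split-first a _))
  triple x∈@(there (here refl)) (there (here refl)) z∈ = ∈-⊕⁺′ (twice x∈) z∈ (sym (split-first m _))
  triple x∈@(here refl) y∈@(there (here refl)) (here refl)         = ∈-⊕⁺′ (twice x∈) y∈ (split-outer a m)
  triple x∈@(here refl) y∈@(there (here refl)) (there (here refl)) = ∈-⊕⁺′ (twice y∈) x∈ (split-inner m a)
  triple x∈@(there (here refl)) y∈@(here refl) (here refl)         = ∈-⊕⁺′ (twice y∈) x∈ (split-inner a m)
  triple x∈@(there (here refl)) y∈@(here refl) (there (here refl)) = ∈-⊕⁺′ (twice x∈) y∈ (split-outer m a)

  from : 3 · P ⊆ D ⊕ P
  from x∈ with ∈-⊕⁻ P (2 · P) x∈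
  ... | _ , _ , x∈P , yz∈ , refl with ∈-⊕⁻ P (1 · P) yz∈
  ... | _ , _ , y∈P , z0∈ , refl with ∈-⊕⁻ P 𝟎 z0∈
  ... | _ , _ , z∈P , here refl , refl = triple x∈P y∈P z∈P

module _ {A : FSet} {a d : ℕ} (a∈A : a ∈ A) (m∈A : a + suc d ∈ A)
         (a≤A : All (a ≤_) A) (A≤m : All (_≤ a + suc d) A) where

  private
    m : ℕ
    m = a + suc d

  exchange : ∀ {b} → b ∈ A → suc d * b ∈ pair a m ⊕ d · A
  exchange b∈A with m≤n⇒∃[o]m+o≡n (lookup a≤A b∈A)
  ... | e , refl with m≤n⇒∃[o]m+o≡n (+-cancelˡ-≤ a e (suc d) (lookup A≤m b∈A))
  ... | r , e+r≡1+d = subst (_∈ pair a m ⊕ d · A) (sym rebalance) (peel a∈A m∈A e r e+r≡1+d)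
    where
    open ≡-Reasoning
    identity : ∀ a e r → (e + r) * (a + e) ≡ e * (a + (e + r)) + r * a
    identity = solve-∀
    rebalance : suc d * (a + e) ≡ e * m + r * a
    rebalance = begin
      suc d * (a + e)            ≡⟨ cong (_* (a + e)) e+r≡1+d ⟨
      (e + r) * (a + e)          ≡⟨ identity a e r ⟩
      e * (a + (e + r)) + r * a  ≡⟨ cong (λ n → e * (a + n) + r * a) e+r≡1+d ⟩
      e * m + r * a              ∎

  stabilises : ∀ j → d * length A ≤ j → pair a m ⊕ j · A ≐ suc j · A
  stabilises j d|A|≤j = ⊆-antisym (⊕-mono-⊆ pair⊆A ⊆-refl) from
    where
    pair⊆A : pair a m ⊆ A
    pair⊆A (here refl)         = a∈A
    pair⊆A (there (here refl)) = m∈A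

    -- some b ∈ A occurs 1 + d times among the 1 + j summands, and (1 + d) b = e m + r a
    from : suc j · A ⊆ pair a m ⊕ j · A
    from x∈ with pigeonhole d (∈-·⇒multisum {A} (suc j) x∈) (s≤s d|A|≤j)
    ... | b , k′ , s′ , b∈A , 1+j≡1+d+k′ , refl , M′ =
      subst (λ n → _ ∈ pair a m ⊕ n · A) (sym (suc-injective 1+j≡1+d+k′))
        (≐⇒⊇ (⊕-cong (≐-refl {pair a m}) (·-distribʳ-+ A d k′))
          (≐⇒⊆ (⊕-assoc (pair a m) (d · A) (k′ · A))
            (∈-⊕⁺ (exchange b∈A) (multisum⇒∈-· {A} ⊆-refl M′))))

  spread-¬absolutelyIrreducible : ∀ {H} → (∀ {X} → H X → NonEmpty X) →
                                  H (pair a m) → H (pair (2 * a) (2 * m)) → ¬ AbsolutelyIrreducible H A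
  spread-¬absolutelyIrreducible {H} H⇒nonEmpty H-pair H-doubled irr =
    factorization H⇒nonEmpty H-pair λ zPair →
    factorization H⇒nonEmpty H-doubled λ zDoubled →
    a+m∉doubled (≐⇒⊇ (doubled≐2A (A≐pair zPair) zDoubled) (∈-⊕⁺ a∈A (∈-⊕⁺ {A} {𝟎} m∈A (here refl))))
    where
    a<m : a < m
    a<m = m<m+n a (s≤s z≤n)

    0<m : 0 < m
    0<m = ≤-<-trans z≤n a<m

    A≐pair : Factorization H (pair a m) → A ≐ pair a m
    A≐pair zPair with summand-of-multiple irr {suc (d * length A)} (s≤s z≤n) zPair (replicateᶠ (d * length A) (proj₁ irr))
                                          (stabilises (d * length A) ≤-refl)
    ... | k , pair≐kA with ·-index {c = 1} {k} m∈A A≤m 0<m (there (here (*-identityˡ m)))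
                                   (≤-trans (<⇒≤ a<m) (≤-reflexive (sym (*-identityˡ m))) ∷ ≤-reflexive (sym (*-identityˡ m)) ∷ [])
                                   pair≐kA
    ... | refl = ≐-sym (≐-trans pair≐kA (·-identityˡ A))

    doubled≐2A : A ≐ pair a m → Factorization H (pair (2 * a) (2 * m)) → pair (2 * a) (2 * m) ≐ 2 · A
    doubled≐2A A≐pair zDoubled with summand-of-multiple irr {3} (s≤s z≤n) zDoubled (replicateᶠ 1 (proj₁ irr)) doubled⊕A≐3A
      where
      doubled⊕A≐3A : pair (2 * a) (2 * m) ⊕ 1 · A ≐ 3 · A
      doubled⊕A≐3A = ≐-trans (⊕-cong (≐-refl {pair (2 * a) (2 * m)}) (≐-trans (·-identityˡ A) A≐pair))
                       (≐-trans (doubled-⊕-pair a m) (·-cong 3 (≐-sym A≐pair)))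
    ... | k , doubled≐kA with ·-index {c = 2} {k} m∈A A≤m 0<m (there (here refl))
                                     (*-monoʳ-≤ 2 (<⇒≤ a<m) ∷ ≤-refl ∷ []) doubled≐kA
    ... | refl = doubled≐kA

    a+m∉doubled : a + (m + 0) ∉ pair (2 * a) (2 * m)
    a+m∉doubled (here a+m≡2a)         = <⇒≢ (+-monoʳ-< a (+-monoˡ-< 0 a<m)) (sym a+m≡2a)
    a+m∉doubled (there (here a+m≡2m)) = <⇒≢ (+-monoˡ-< (m + 0) a<m) a+m≡2m

extremes : ∀ {A} → NonEmpty A → ∃₂ λ a m → a ∈ A × m ∈ A × All (a ≤_) A × All (_≤ m) A
extremes {[]}     (_ , ())
extremes {x ∷ xs} _ =
  min x xs , max x xs ,
  [ here , there ]′ (argmin-sel (λ y → y) x xs) , [ here , there ]′ (argmax-sel (λ y → y) x xs) ,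
  min≤⊤ x xs ∷ min≤xs x xs , ⊥≤max x xs ∷ xs≤max x xs

singleton-or-spread : ∀ {A} → NonEmpty A →
  (∃ λ a → A ≐ [ a ]) ⊎ (∃₂ λ a d → a ∈ A × a + suc d ∈ A × All (a ≤_) A × All (_≤ a + suc d) A)
singleton-or-spread {A} neA with extremes neA
... | a , m , a∈A , m∈A , a≤A , A≤m with m≤n⇒∃[o]m+o≡n (lookup a≤A m∈A)
... | zero  , refl = inj₁ (a , ⊆-antisym (λ x∈A → here (≤-antisym (x≤a x∈A) (lookup a≤A x∈A)))
                                        λ { (here refl) → a∈A ; (there ()) })
  where
  x≤a : ∀ {x} → x ∈ A → x ≤ a
  x≤a x∈A = ≤-trans (lookup A≤m x∈A) (≤-reflexive (+-identityʳ a))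
... | suc d , refl = inj₂ (a , d , a∈A , m∈A , a≤A , A≤m)

-- Numerical monoids

module _ (S : NumericalMonoid) where
  open NumericalMonoid S

  mem-* : ∀ k {s} → mem s → mem (k * s)
  mem-* zero    s∈S = mem-0
  mem-* (suc k) s∈S = mem-+ s∈S (mem-* k s∈S)

  Pfin-pair : ∀ {A a m} → Pfin S A → a ∈ A → m ∈ A → Pfin S (pair a m)
  Pfin-pair (_ , A⊆S) a∈A m∈A = (_ , here refl) , lookup A⊆S a∈A ∷ lookup A⊆S m∈A ∷ []

  Pfin-doubled : ∀ {A a m} → Pfin S A → a ∈ A → m ∈ A → Pfin S (pair (2 * a) (2 * m))
  Pfin-doubled (_ , A⊆S) a∈A m∈A = (_ , here refl) , mem-* 2 (lookup A⊆S a∈A) ∷ mem-* 2 (lookup A⊆S m∈A) ∷ []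

  singleton-absolutelyIrreducible⇒∣ : ∀ {A a s} → AbsolutelyIrreducible (Pfin S) A → A ≐ [ a ] → mem s → a ∣ s
  singleton-absolutelyIrreducible⇒∣ {a = zero} irr A≐𝟎 _ = ⊥-elim (proj₁ (proj₂ (proj₁ irr)) A≐𝟎)
  singleton-absolutelyIrreducible⇒∣ {s = zero} _ _ _ = _ ∣0
  singleton-absolutelyIrreducible⇒∣ {A} {suc a} {suc s} irr A≐[1+a] s∈S with suc a ∣? suc s
  ... | yes 1+a∣1+s = 1+a∣1+s
  ... | no 1+a∤1+s = ⊥-elim (
    factorization proj₁ (Pfin-[] s∈S) λ z[s] →
    factorization proj₁ (Pfin-[] (mem-* a s∈S)) λ z[as] →
    let k , [s]≐kA = summand-of-multiple irr {suc s} (s≤s z≤n) z[s] z[as] [s]⊕[as]≐sA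
    in 1+a∤1+s (divides k (≐-[]⇒≡ (≐-trans [s]≐kA (≐-trans (·-cong k A≐[1+a]) (≐-reflexive (·-[] k (suc a))))))))
    where
    Pfin-[] : ∀ {x} → mem x → Pfin S [ x ]
    Pfin-[] x∈S = (_ , here refl) , x∈S ∷ []

    [s]⊕[as]≐sA : [ suc s ] ⊕ [ a * suc s ] ≐ suc s · A
    [s]⊕[as]≐sA = ≐-trans (≐-reflexive (cong [_] (*-comm (suc a) (suc s))))
                    (≐-trans (≐-reflexive (sym (·-[] (suc s) (suc a)))) (·-cong (suc s) (≐-sym A≐[1+a])))

  Pfin0-¬absolutelyIrreducible : ∀ A → ¬ AbsolutelyIrreducible (Pfin0 S) A
  Pfin0-¬absolutelyIrreducible A irr with proj₁ (proj₁ irr)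
  ... | A∈Pfin@(neA , _) , 0∈A with singleton-or-spread neA
  ... | inj₁ (a , A≐[a]) with singleton⁻ (≐⇒⊆ A≐[a] 0∈A)
  ...   | refl = proj₁ (proj₂ (proj₁ irr)) A≐[a]
  Pfin0-¬absolutelyIrreducible A irr
      | A∈Pfin , 0∈A | inj₂ (a , d , a∈A , m∈A , a≤A , A≤m) with n≤0⇒n≡0 (lookup a≤A 0∈A)
  ... | refl = spread-¬absolutelyIrreducible a∈A m∈A a≤A A≤m (λ h → proj₁ (proj₁ h))
                 (Pfin-pair A∈Pfin a∈A m∈A , here refl) (Pfin-doubled A∈Pfin a∈A m∈A , here refl) irr

  Pfin-absolutelyIrreducible⇒≐[1] : ∀ A → AbsolutelyIrreducible (Pfin S) A → A ≐ [ 1 ]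
  Pfin-absolutelyIrreducible⇒≐[1] A irr with singleton-or-spread (proj₁ (proj₁ (proj₁ irr)))
  ... | inj₁ (a , A≐[a]) =
    subst (λ a → A ≐ [ a ]) (gcd-one a (λ s → singleton-absolutelyIrreducible⇒∣ irr A≐[a])) A≐[a]
  ... | inj₂ (a , d , a∈A , m∈A , a≤A , A≤m) = ⊥-elim (spread-¬absolutelyIrreducible a∈A m∈A a≤A A≤m proj₁
          (Pfin-pair (proj₁ (proj₁ irr)) a∈A m∈A) (Pfin-doubled (proj₁ (proj₁ irr)) a∈A m∈A) irr)

-- The element {1} of P_fin(ℕ₀)

[1]-atom : IsAtom (Pfin ℕ₀) [ 1 ]
[1]-atom = ((1 , here refl) , tt ∷ []) , positive⇒≉𝟎 (here refl) (s≤s z≤n) , splits-trivially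
  where
  splits-trivially : ∀ B C → Pfin ℕ₀ B → Pfin ℕ₀ C → [ 1 ] ≐ B ⊕ C → B ≐ 𝟎 ⊎ C ≐ 𝟎
  splits-trivially B C (neB , _) (neC , _) [1]≐B⊕C with ⊕≐[]⁻ neB neC (≐-sym [1]≐B⊕C)
  ... | zero       , _      , B≐𝟎 , _   , _  = inj₁ B≐𝟎
  ... | suc zero   , zero   , _   , C≐𝟎 , _  = inj₂ C≐𝟎
  ... | suc zero   , suc _  , _   , _   , ()
  ... | suc (suc _) , _     , _   , _   , ()

singleton-atom⇒≐[1] : ∀ {Y y} → IsAtom (Pfin ℕ₀) Y → Y ≐ [ y ] → Y ≐ [ 1 ]
singleton-atom⇒≐[1] {y = zero}        Y-atom Y≐𝟎  = ⊥-elim (proj₁ (proj₂ Y-atom) Y≐𝟎)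
singleton-atom⇒≐[1] {y = suc zero}    Y-atom Y≐[1] = Y≐[1]
singleton-atom⇒≐[1] {y = suc (suc y)} Y-atom Y≐[2+y]
  with proj₂ (proj₂ Y-atom) [ 1 ] [ suc y ] ((_ , here refl) , tt ∷ []) ((_ , here refl) , tt ∷ []) Y≐[2+y]
... | inj₁ [1]≐𝟎   = ⊥-elim (positive⇒≉𝟎 (here refl) (s≤s z≤n) [1]≐𝟎)
... | inj₂ [1+y]≐𝟎 = ⊥-elim (positive⇒≉𝟎 (here refl) (s≤s z≤n) [1+y]≐𝟎)

atoms-of-singleton : ∀ {t} xs → All (IsAtom (Pfin ℕ₀)) xs → Σset xs ≐ [ t ] → All (_≐ [ 1 ]) xs
atoms-of-singleton []       []                _ = []
atoms-of-singleton (Y ∷ xs) (Y-atom ∷ atoms) Σ≐[t]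
  with ⊕≐[]⁻ (proj₁ (proj₁ Y-atom)) (Σset-nonEmpty xs (All.map (λ atom → proj₁ (proj₁ atom)) atoms)) Σ≐[t]
... | _ , _ , Y≐[y] , Σxs≐[w] , _ = singleton-atom⇒≐[1] Y-atom Y≐[y] ∷ atoms-of-singleton xs atoms Σxs≐[w]

module _ (n : ℕ) (z : Factorization (Pfin ℕ₀) (n · [ 1 ])) where
  open Factorization z

  factorization-of-[n]-ones : All (_≐ [ 1 ]) atoms
  factorization-of-[n]-ones = atoms-of-singleton atoms all-atom (≐-trans sums-to (≐-reflexive (·-[] n 1)))

  factorization-of-[n]-length : length atoms ≡ n
  factorization-of-[n]-length = *-cancelʳ-≡ (length atoms) n 1 (≐-[]⇒≡ (begin
    [ length atoms * 1 ]   ≡⟨ ·-[] (length atoms) 1 ⟨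
    length atoms · [ 1 ]  ≈⟨ Σset-all≐ atoms factorization-of-[n]-ones ⟨
    Σset atoms            ≈⟨ sums-to ⟩
    n · [ 1 ]             ≡⟨ ·-[] n 1 ⟩
    [ n * 1 ]             ∎))
    where open SetoidReasoning FSetSetoid

[1]-absolutelyIrreducible : AbsolutelyIrreducible (Pfin ℕ₀) [ 1 ]
[1]-absolutelyIrreducible = [1]-atom , λ n _ →
  replicateᶠ n [1]-atom ,
  λ z₁ z₂ → all≐-↭ (factorization-of-[n]-ones n z₁) (factorization-of-[n]-ones n z₂)
                   (trans (factorization-of-[n]-length n z₁) (sym (factorization-of-[n]-length n z₂)))

theorem4p11 : (S : NumericalMonoid) →
    AbsolutelyIrreducible (Pfin ℕ₀) [ 1 ] ×
    (∀ A → AbsolutelyIrreducible (Pfin0 S) A → ⊥) ×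
    (∀ A → AbsolutelyIrreducible (Pfin S) A → A ≐ [ 1 ])
theorem4p11 S = [1]-absolutelyIrreducible , Pfin0-¬absolutelyIrreducible S , Pfin-absolutelyIrreducible⇒≐[1] S
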